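{- Let $\mathfrak{m}=(H,\alpha,\sigma)$ be a rooted unicellular map of genus $g$ with face permutation $\gamma=\alpha\sigma$, and let $a_1<_{\mathfrak{m}}a_2<_{\mathfrak{m}}a_3$ be three half-edges belonging to three distinct vertices $v_i=(a_i,h_i^1,\dots,h_i^{m_i})$, $i=1,2,3$ (with $m_i\ge 0$). Let $\bar\sigma$ be the permutation of $H$ obtained from $\sigma$ by deleting the cycles $v_1,v_2,v_3$ and replacing them by the single cycle $$\bar v=(a_1,h_2^1,\dots,h_2^{m_2},a_2,h_3^1,\dots,h_3^{m_3},a_3,h_1^1,\dots,h_1^{m_1}).$$ Then $\bar{\mathfrak{m}}=(H,\alpha,\bar\sigma)$ (with the same root) is a unicellular map of genus $g+1$. Moreover, if $\gamma=(a_1,k_1^1,\dots,k_1^{l_1},a_2,k_2^1,\dots,k_2^{l_2},a_3,k_3^1,\dots,k_3^{l_3})$, then the face permutation of $\bar{\mathfrak{m}}$ is $$\bar\gamma=\alpha\bar\sigma=(a_1,k_2^1,\dots,k_2^{l_2},a_3,k_1^1,\dots,k_1^{l_1},a_2,k_3^1,\dots,k_3^{l_3}).$$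
   Context: A unicellular map with $n$ edges is a triple $\mathfrak{m}=(H,\alpha,\sigma)$ where $H$ is a set of $2n$ elements (half-edges), $\alpha$ is a fixed-point-free involution of $H$, and $\sigma$ is a permutation of $H$ such that $\gamma=\alpha\sigma$ (i.e. $\gamma(h)=\alpha(\sigma(h))$) consists of a single cycle; $\gamma$ is the face, the cycles of $\alpha$ are the edges and the cycles of $\sigma$ are the vertices. A rooted map carries a distinguished half-edge $r$ (the root). The genus $g$ is defined by $v=n+1-2g$, where $v$ is the number of vertices. The total order $<_{\mathfrak{m}}$ on $H$ is defined by $r<_{\mathfrak{m}}\gamma(r)<_{\mathfrak{m}}\gamma^2(r)<_{\mathfrak{m}}\dots<_{\mathfrak{m}}\gamma^{2n-1}(r)$. -}

module Defs where

open import Data.Nat using (ℕ; zero; suc; _+_; _*_; _<_; _≤_)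
open import Data.Fin using (Fin; toℕ)
open import Data.Fin.Permutation using (Permutation′; _⟨$⟩ʳ_)
open import Data.List using (List; []; _∷_; length; filter; upTo; allFin)
open import Data.List.Relation.Unary.All using (All; all?)
open import Data.List.Relation.Unary.Unique.Propositional using (Unique)
open import Data.List.Membership.Propositional using (_∈_)
open import Data.Product using (Σ; ∃; _×_)
open import Data.Unit using (⊤)
open import Relation.Binary.PropositionalEquality using (_≡_)
open import Relation.Nullary using (¬_)
import Data.Nat.Properties as ℕP

-- Half-edges of a map with n edges: H = Fin (2 * n).
Half : ℕ → Set
Half n = Fin (2 * n)

iter : {A : Set} → (A → A) → ℕ → A → A
iter f zero    x = x
iter f (suc k) x = f (iter f k x)

face : (n : ℕ) → Permutation′ (2 * n) → Permutation′ (2 * n) → Half n → Half n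
face n α σ h = α ⟨$⟩ʳ (σ ⟨$⟩ʳ h)

chain : {A : Set} → (A → A) → A → List A → Set
chain f x₀ []           = ⊤
chain f x₀ (y ∷ [])     = f y ≡ x₀
chain f x₀ (y ∷ z ∷ zs) = (f y ≡ z) × chain f x₀ (z ∷ zs)

-- (x₁, …, xₖ) is a cycle of f (cycle notation): the xᵢ are distinct,
-- f xᵢ = xᵢ₊₁ and f xₖ = x₁.
CycleOf : {A : Set} → (A → A) → List A → Set
CycleOf f []       = ⊤
CycleOf f (x ∷ xs) = Unique (x ∷ xs) × chain f x (x ∷ xs)

IsCycle : {A : Set} → (A → A) → List A → Set
IsCycle {A} f xs = CycleOf f xs × ((h : A) → h ∈ xs)

SingleCycle : {A : Set} → (A → A) → Set
SingleCycle {A} f = Σ (List A) (λ xs → IsCycle f xs)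

FixedPointFreeInvolution : (n : ℕ) → Permutation′ (2 * n) → Set
FixedPointFreeInvolution n α =
  ((h : Half n) → α ⟨$⟩ʳ (α ⟨$⟩ʳ h) ≡ h) × ((h : Half n) → ¬ (α ⟨$⟩ʳ h ≡ h))

IsUnicellular : (n : ℕ) → Permutation′ (2 * n) → Permutation′ (2 * n) → Set
IsUnicellular n α σ = FixedPointFreeInvolution n α × SingleCycle (face n α σ)

SameVertex : (n : ℕ) → Permutation′ (2 * n) → Half n → Half n → Set
SameVertex n σ a b = ∃ λ k → iter (σ ⟨$⟩ʳ_) k a ≡ b

-- number of cycles of σ (= number of vertices) = number of half-edges h that
-- are minimal (in the order of Fin) among σ^k(h), k < 2n; each cycle has
-- exactly one such element.
numCycles : (n : ℕ) → Permutation′ (2 * n) → ℕ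
numCycles n σ =
  length (filter (λ h → all? (λ k → toℕ h ℕP.≤? toℕ (iter (σ ⟨$⟩ʳ_) k h)) (upTo (2 * n)))
                 (allFin (2 * n)))

-- genus g : v = n + 1 - 2g, where v is the number of vertices.
HasGenus : (n : ℕ) → Permutation′ (2 * n) → ℕ → Set
HasGenus n σ g = numCycles n σ + 2 * g ≡ n + 1

-- The total order <_m : r <_m γ(r) <_m … <_m γ^{2n-1}(r).
MapLt : (n : ℕ) → Permutation′ (2 * n) → Permutation′ (2 * n) → Half n →
        Half n → Half n → Set
MapLt n α σ r a b =
  ∃ λ i → ∃ λ j → i < j × j < 2 * n ×
    iter (face n α σ) i r ≡ a × iter (face n α σ) j r ≡ b

module Submission where

-- For a
-- function on Fin N with one cycle, reading the cycle from r gives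
-- r, f r, …, f^{N-1} r, so a₁ <_m a₂ <_m a₃ splits it as (a₁ B a₂ C a₃ K)
-- ('ordered-cycle').  In the setting of the theorem (module
-- Merge), comparing the segments of the merged vertex with the three old
-- vertices shows that σ̄ is σ modified at a₁, a₂, a₃ exactly as above, so
-- γ̄ = ασ̄ is the exchanged face; and the three orbit minima of the old
-- vertices become one, so v drops by 2 and the genus rises by 1.

open import Defs
open import Data.Nat using (ℕ; zero; suc; _+_; _*_; _<_; _≤_; z≤n; s≤s; s≤s⁻¹)
open import Data.Nat.Properties
  using (≤-trans; ≤-reflexive; ≤-antisym; <-≤-trans; <-trans; *-suc; +-assoc; _≤?_)
open import Data.Fin using (Fin; toℕ; _≟_)
open import Data.Fin.Properties using (toℕ-injective)
open import Data.Fin.Permutation using (Permutation′; _⟨$⟩ʳ_)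
open import Data.List using (List; []; _∷_; _++_; length; filter; upTo; allFin)
open import Data.List.Properties
  using ( ++-identityʳ; ++-assoc; ∷-injective; ∷-injectiveʳ
        ; length-++; length-++-sucʳ; length-tabulate)
open import Data.List.Extrema.Nat using (argmin; argmin-sel; f[argmin]≤f[⊤]; f[argmin]≤f[xs])
open import Data.List.Membership.Propositional using (_∈_; _∉_)
open import Data.List.Membership.Propositional.Properties
  using (∈-∃++; ∈-++⁺ˡ; ∈-++⁺ʳ; ∈-++⁻; ∈-filter⁺; ∈-filter⁻; ∈-allFin; ∈-upTo⁺)
open import Data.List.Relation.Unary.Any using (here; there)
open import Data.List.Relation.Unary.All as All using (All; all?; []; _∷_)
open import Data.List.Relation.Unary.AllPairs using ([]; _∷_)
open import Data.List.Relation.Unary.Unique.Propositional using (Unique)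
open import Data.List.Relation.Unary.Unique.Propositional.Properties using (allFin⁺; filter⁺; ++⁺)
open import Data.List.Relation.Binary.Permutation.Propositional
  using (_↭_; ↭-sym; ↭-trans; ↭-reflexive; ↭-prep; ↭-swap; ↭⇒↭ₛ)
open import Data.List.Relation.Binary.Permutation.Propositional.Properties
  using (∈-resp-↭; ↭-length; ++-comm; shift; shifts)
import Data.List.Relation.Binary.Permutation.Setoid.Properties as SetoidPerm
open import Data.Product using (_×_; ∃-syntax; ∃₂; _,_; proj₁; proj₂)
open import Data.Sum using (_⊎_; inj₁; inj₂)
open import Data.Unit using (tt)
open import Data.Empty using (⊥-elim)
open import Function using (_∘_; _⇔_; mk⇔; Equivalence; Injection)
open import Function.Properties.Inverse using (↔⇒↣)
open import Level using (0ℓ)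
open import Relation.Binary.PropositionalEquality
  using (_≡_; _≢_; refl; sym; trans; cong; subst; subst₂; setoid; module ≡-Reasoning)
open import Relation.Nullary using (¬_; yes; no; ¬?)
open import Relation.Nullary.Decidable using (_×-dec_)
open import Relation.Unary using (Pred; Decidable)

iter-suc : ∀ {A : Set} (f : A → A) k x → iter f (suc k) x ≡ iter f k (f x)
iter-suc f zero    x = refl
iter-suc f (suc k) x = cong f (iter-suc f k x)

iter-+ : ∀ {A : Set} (f : A → A) j k x → iter f k (iter f j x) ≡ iter f (k + j) x
iter-+ f j zero    x = refl
iter-+ f j (suc k) x = cong f (iter-+ f j k x)

unique-↭ : ∀ {A : Set} {xs ys : List A} → xs ↭ ys → Unique xs → Unique ys
unique-↭ {A} p = SetoidPerm.Unique-resp-↭ (setoid A) (↭⇒↭ₛ p)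

module _ {A : Set} where

  unique-length≤ : ∀ {xs ys : List A} → Unique xs → (∀ {z} → z ∈ xs → z ∈ ys) →
                   length xs ≤ length ys
  unique-length≤ {[]}     _            _   = z≤n
  unique-length≤ {x ∷ xs} (x∉xs ∷ u) sub with ∈-∃++ (sub (here refl))
  ... | ys₁ , ys₂ , refl =
    ≤-trans (s≤s (unique-length≤ u sub′)) (≤-reflexive (sym (length-++-sucʳ ys₁ x ys₂)))
    where
    sub′ : ∀ {z} → z ∈ xs → z ∈ ys₁ ++ ys₂
    sub′ z∈xs with ∈-++⁻ ys₁ (sub (there z∈xs))
    ... | inj₁ z∈ys₁          = ∈-++⁺ˡ z∈ys₁
    ... | inj₂ (here refl)    = ⊥-elim (All.lookup x∉xs z∈xs refl)
    ... | inj₂ (there z∈ys₂)  = ∈-++⁺ʳ ys₁ z∈ys₂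

  unique-same-length : ∀ {xs ys : List A} → Unique xs → Unique ys →
    (∀ {z} → z ∈ xs ⇔ z ∈ ys) → length xs ≡ length ys
  unique-same-length uxs uys xs≈ys = ≤-antisym
    (unique-length≤ uxs (Equivalence.to xs≈ys)) (unique-length≤ uys (Equivalence.from xs≈ys))

  unique-position : ∀ {a : A} P {Q} P′ {Q′} → Unique (P ++ a ∷ Q) →
                    P ++ a ∷ Q ≡ P′ ++ a ∷ Q′ → Q ≡ Q′
  unique-position []      []       _          e = ∷-injectiveʳ e
  unique-position []      (p ∷ P′) (a∉ ∷ _)  e with ∷-injective e
  ... | refl , Q≡ = ⊥-elim (All.lookup a∉ (subst (_ ∈_) (sym Q≡) (∈-++⁺ʳ P′ (here refl))) refl)
  unique-position (p ∷ P) []       (p∉ ∷ _)  e with ∷-injective e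
  ... | refl , _  = ⊥-elim (All.lookup p∉ (∈-++⁺ʳ P (here refl)) refl)
  unique-position (p ∷ P) (_ ∷ P′) (_ ∷ u)   e = unique-position P P′ u (∷-injectiveʳ e)

  occurs-before : ∀ {a b : A} P {Q} P′ {Q′} → P ++ a ∷ Q ≡ P′ ++ b ∷ Q′ →
                  length P < length P′ → ∃[ B ] Q ≡ B ++ b ∷ Q′
  occurs-before []      (_ ∷ P′) e _         = P′ , ∷-injectiveʳ e
  occurs-before (_ ∷ P) (_ ∷ P′) e (s≤s lt) = occurs-before P P′ (∷-injectiveʳ e) lt

  -- Occurrences of a before b and of b before c in a duplicate-free list
  -- combine into one decomposition (the two occurrences of b coincide).
  in-order : ∀ {a b c : A} {L} Pa {Qa} Pb {Qb} Pb′ {Qb′} Pc {Qc} → Unique L →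
    L ≡ Pa ++ a ∷ Qa → L ≡ Pb ++ b ∷ Qb → L ≡ Pb′ ++ b ∷ Qb′ → L ≡ Pc ++ c ∷ Qc →
    length Pa < length Pb → length Pb′ < length Pc →
    ∃₂ λ B C → L ≡ Pa ++ a ∷ B ++ b ∷ C ++ c ∷ Qc
  in-order {a} {b} {c} Pa {Qa} Pb {Qb} Pb′ {Qb′} Pc {Qc} u La Lb Lb′ Lc a<b b<c
    with occurs-before Pa Pb (trans (sym La) Lb) a<b
       | occurs-before Pb′ Pc (trans (sym Lb′) Lc) b<c
  ... | B , Qa≡ | C , Qb′≡ = B , C , (begin
      _                            ≡⟨ La ⟩
      Pa ++ a ∷ Qa                 ≡⟨ cong (λ w → Pa ++ a ∷ w) Qa≡ ⟩
      Pa ++ a ∷ B ++ b ∷ Qb        ≡⟨ cong (λ w → Pa ++ a ∷ B ++ b ∷ w) Qb≡Qb′ ⟩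
      Pa ++ a ∷ B ++ b ∷ Qb′       ≡⟨ cong (λ w → Pa ++ a ∷ B ++ b ∷ w) Qb′≡ ⟩
      Pa ++ a ∷ B ++ b ∷ C ++ c ∷ Qc ∎)
    where
    open ≡-Reasoning
    Qb≡Qb′ : Qb ≡ Qb′
    Qb≡Qb′ = unique-position Pb Pb′ (subst Unique Lb u) (trans (sym Lb) Lb′)

  gather : ∀ (a₁ a₂ a₃ : A) K₁ K₂ K₃ →
           a₁ ∷ K₁ ++ a₂ ∷ K₂ ++ a₃ ∷ K₃ ↭ a₁ ∷ a₂ ∷ a₃ ∷ K₁ ++ K₂ ++ K₃
  gather a₁ a₂ a₃ K₁ K₂ K₃ = ↭-prep a₁ (↭-trans (shift a₂ K₁ (K₂ ++ a₃ ∷ K₃)) (↭-prep a₂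
    (↭-trans (↭-reflexive (sym (++-assoc K₁ K₂ (a₃ ∷ K₃))))
    (↭-trans (shift a₃ (K₁ ++ K₂) K₃) (↭-prep a₃ (↭-reflexive (++-assoc K₁ K₂ K₃)))))))

  exchange-↭ : ∀ (a₁ a₂ a₃ : A) K₁ K₂ K₃ →
               a₁ ∷ K₁ ++ a₂ ∷ K₂ ++ a₃ ∷ K₃ ↭ a₁ ∷ K₂ ++ a₃ ∷ K₁ ++ a₂ ∷ K₃
  exchange-↭ a₁ a₂ a₃ K₁ K₂ K₃ = ↭-trans (gather a₁ a₂ a₃ K₁ K₂ K₃)
    (↭-trans (↭-prep a₁ (↭-swap a₂ a₃ (shifts K₁ K₂))) (↭-sym (gather a₁ a₃ a₂ K₂ K₁ K₃)))

  unmarked : ∀ {a₁ a₂ a₃ : A} K₁ K₂ K₃ → Unique (a₁ ∷ K₁ ++ a₂ ∷ K₂ ++ a₃ ∷ K₃) →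
             ∀ {k} → k ∈ K₁ ++ K₂ ++ K₃ → k ≢ a₁ × k ≢ a₂ × k ≢ a₃
  unmarked {a₁} {a₂} {a₃} K₁ K₂ K₃ u k∈
    with unique-↭ (gather a₁ a₂ a₃ K₁ K₂ K₃) u
  ... | (_ ∷ _ ∷ a₁∉) ∷ (_ ∷ a₂∉) ∷ a₃∉ ∷ _ =
    (λ e → All.lookup a₁∉ k∈ (sym e)) , (λ e → All.lookup a₂∉ k∈ (sym e)) ,
    (λ e → All.lookup a₃∉ k∈ (sym e))

module _ {A : Set} where

  chain-split : ∀ {f : A → A} {z y} xs {ys} → chain f z (xs ++ y ∷ ys) →
                chain f y xs × chain f z (y ∷ ys)
  chain-split []             c       = tt , c
  chain-split (x ∷ [])       (e , c) = e , c
  chain-split (x ∷ x′ ∷ xs) (e , c) =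
    let c₁ , c₂ = chain-split (x′ ∷ xs) c in (e , c₁) , c₂

  chain-join : ∀ {f : A → A} {z y} xs {ys} → chain f y xs → chain f z (y ∷ ys) →
               chain f z (xs ++ y ∷ ys)
  chain-join []             _        c = c
  chain-join (x ∷ [])       e        c = e , c
  chain-join (x ∷ x′ ∷ xs) (e , c₁) c = e , chain-join (x′ ∷ xs) c₁ c

  chain-retarget : ∀ {f g : A → A} {z x y} K → chain f z (x ∷ K) → g y ≡ f x →
                   (∀ {k} → k ∈ K → g k ≡ f k) → chain g z (y ∷ K)
  chain-retarget []      c        e _     = trans e c
  chain-retarget (k ∷ K) (c₀ , c) e agree =
    trans e c₀ , chain-retarget K c (agree (here refl)) (agree ∘ there)

  chain-agree : ∀ {f g : A → A} {z x y} K → chain f z (x ∷ K) → chain g z (y ∷ K) →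
                g y ≡ f x × (∀ {k} → k ∈ K → g k ≡ f k)
  chain-agree []      c        d        = trans d (sym c) , λ ()
  chain-agree (k ∷ K) (c₀ , c) (d₀ , d) =
    let e , agree = chain-agree K c d in
    trans d₀ (sym c₀) , λ { (here refl) → e ; (there k∈) → agree k∈ }

  chain-reach : ∀ {f : A → A} {z} y ys → chain f z (y ∷ ys) → ∀ {c} → c ∈ y ∷ ys →
                ∃[ k ] k ≤ length ys × iter f k y ≡ c
  chain-reach y ys         _       (here refl) = 0 , z≤n , refl
  chain-reach {f} y (y′ ∷ ys) (e , c) (there m) =
    let k , k≤ , eq = chain-reach y′ ys c m in
    suc k , s≤s k≤ , trans (iter-suc f k y) (trans (cong (iter f k) e) eq)

  chain-position : ∀ {f : A → A} {z} y ys → chain f z (y ∷ ys) → ∀ k → k ≤ length ys →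
                   ∃₂ λ P Q → y ∷ ys ≡ P ++ iter f k y ∷ Q × length P ≡ k
  chain-position y ys         _       zero    _        = [] , ys , refl , refl
  chain-position {f} y (y′ ∷ ys) (e , c) (suc k) (s≤s k≤) =
    let P , Q , eq , len = chain-position y′ ys c k k≤ in
    y ∷ P , Q , cong (y ∷_) (trans eq (cong (λ w → P ++ w ∷ Q) (sym step))) , cong suc len
    where
    step : iter f (suc k) y ≡ iter f k y′
    step = trans (iter-suc f k y) (cong (iter f k) e)

  chain-last : ∀ {f : A → A} {z} y ys → chain f z (y ∷ ys) → ∃[ p ] p ∈ y ∷ ys × f p ≡ z
  chain-last y []         c       = y , here refl , c
  chain-last y (y′ ∷ ys) (_ , c) = let p , p∈ , e = chain-last y′ ys c in p , there p∈ , e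

  rotate : ∀ {f : A → A} xs {y ys} → CycleOf f (xs ++ y ∷ ys) → CycleOf f (y ∷ ys ++ xs)
  rotate []       {ys = ys} cyc rewrite ++-identityʳ ys = cyc
  rotate (x ∷ xs) {y} {ys}  (u , c) =
    let c₁ , c₂ = chain-split (x ∷ xs) c in
    unique-↭ (++-comm (x ∷ xs) (y ∷ ys)) u , chain-join (y ∷ ys) c₂ c₁

  rotate-full : ∀ {f : A → A} xs {y ys} → IsCycle f (xs ++ y ∷ ys) → IsCycle f (y ∷ ys ++ xs)
  rotate-full xs {y} {ys} (cyc , covers) =
    rotate xs cyc , λ h → ∈-resp-↭ (++-comm xs (y ∷ ys)) (covers h)

  restart : ∀ {f : A → A} {L h} → CycleOf f L → h ∈ L → ∃[ hs ] CycleOf f (h ∷ hs) × L ↭ h ∷ hs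
  restart cyc h∈L with ∈-∃++ h∈L
  ... | xs , ys , refl = ys ++ xs , rotate xs cyc , ++-comm xs (_ ∷ ys)

  cycle-unique : ∀ {f : A → A} {L} → CycleOf f L → Unique L
  cycle-unique {L = []}    _       = []
  cycle-unique {L = _ ∷ _} (u , _) = u

  cycle-reach : ∀ {f : A → A} {L h c} → CycleOf f L → h ∈ L → c ∈ L →
                ∃[ k ] k < length L × iter f k h ≡ c
  cycle-reach cyc h∈L c∈L with restart cyc h∈L
  ... | hs , (_ , ch) , L↭ =
    let k , k≤ , eq = chain-reach _ hs ch (∈-resp-↭ L↭ c∈L) in
    k , subst (k <_) (sym (↭-length L↭)) (s≤s k≤) , eq

  cycle-closed : ∀ {f : A → A} {L c} → CycleOf f L → c ∈ L → f c ∈ L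
  cycle-closed cyc c∈L with restart cyc c∈L
  ... | []    , (_ , e)     , L↭ = ∈-resp-↭ (↭-sym L↭) (here e)
  ... | _ ∷ _ , (_ , e , _) , L↭ = ∈-resp-↭ (↭-sym L↭) (there (here e))

  cycle-iter : ∀ {f : A → A} {L x} → CycleOf f L → x ∈ L → ∀ k → iter f k x ∈ L
  cycle-iter cyc x∈L zero    = x∈L
  cycle-iter cyc x∈L (suc k) = cycle-closed cyc (cycle-iter cyc x∈L k)

  cycle-closed⁻ : ∀ {f : A → A} {L x} → (∀ {x y} → f x ≡ f y → x ≡ y) → CycleOf f L →
                  f x ∈ L → x ∈ L
  cycle-closed⁻ f-inj cyc fx∈L with restart cyc fx∈L
  ... | cs , (_ , ch) , L↭ with chain-last _ cs ch
  ...   | p , p∈ , fp≡fx = subst (_∈ _) (f-inj fp≡fx) (∈-resp-↭ (↭-sym L↭) p∈)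

  cycles-meet : ∀ {f : A → A} {a b as bs z} → CycleOf f (a ∷ as) → CycleOf f (b ∷ bs) →
                z ∈ a ∷ as → z ∈ b ∷ bs → ∃[ k ] iter f k a ≡ b
  cycles-meet {f} {a} cyc₁ cyc₂ z∈₁ z∈₂
    with cycle-reach cyc₁ (here refl) z∈₁ | cycle-reach cyc₂ z∈₂ (here refl)
  ... | j , _ , a↦z | k , _ , z↦b =
    k + j , trans (sym (iter-+ f j k a)) (trans (cong (iter f k) a↦z) z↦b)

  exchange : ∀ {f g : A → A} {a₁ a₂ a₃} K₁ K₂ K₃ →
    g a₁ ≡ f a₂ → g a₂ ≡ f a₃ → g a₃ ≡ f a₁ →
    (∀ h → h ≢ a₁ → h ≢ a₂ → h ≢ a₃ → g h ≡ f h) →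
    IsCycle f (a₁ ∷ K₁ ++ a₂ ∷ K₂ ++ a₃ ∷ K₃) → IsCycle g (a₁ ∷ K₂ ++ a₃ ∷ K₁ ++ a₂ ∷ K₃)
  exchange {f} {g} {a₁} {a₂} {a₃} K₁ K₂ K₃ e₁ e₂ e₃ off ((u , c) , covers) =
    (unique-↭ perm u , chain-join (a₁ ∷ K₂) seg₂ (chain-join (a₃ ∷ K₁) seg₁ seg₃)) ,
    λ h → ∈-resp-↭ perm (covers h)
    where
    perm : a₁ ∷ K₁ ++ a₂ ∷ K₂ ++ a₃ ∷ K₃ ↭ a₁ ∷ K₂ ++ a₃ ∷ K₁ ++ a₂ ∷ K₃
    perm = exchange-↭ a₁ a₂ a₃ K₁ K₂ K₃
    agree : ∀ {k} → k ∈ K₁ ++ K₂ ++ K₃ → g k ≡ f k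
    agree k∈ = let p , q , r = unmarked K₁ K₂ K₃ u k∈ in off _ p q r
    c₁ : chain f a₂ (a₁ ∷ K₁)
    c₁ = proj₁ (chain-split (a₁ ∷ K₁) c)
    c₂₃ : chain f a₁ (a₂ ∷ K₂ ++ a₃ ∷ K₃)
    c₂₃ = proj₂ (chain-split (a₁ ∷ K₁) c)
    c₂ : chain f a₃ (a₂ ∷ K₂)
    c₂ = proj₁ (chain-split (a₂ ∷ K₂) c₂₃)
    c₃ : chain f a₁ (a₃ ∷ K₃)
    c₃ = proj₂ (chain-split (a₂ ∷ K₂) c₂₃)
    seg₂ : chain g a₃ (a₁ ∷ K₂)
    seg₂ = chain-retarget K₂ c₂ e₁ (agree ∘ ∈-++⁺ʳ K₁ ∘ ∈-++⁺ˡ)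
    seg₁ : chain g a₂ (a₃ ∷ K₁)
    seg₁ = chain-retarget K₁ c₁ e₃ (agree ∘ ∈-++⁺ˡ)
    seg₃ : chain g a₁ (a₂ ∷ K₃)
    seg₃ = chain-retarget K₃ c₃ e₂ (agree ∘ ∈-++⁺ʳ K₁ ∘ ∈-++⁺ʳ K₂)

module _ {N : ℕ} {f : Fin N → Fin N} where

  full-cycle-length : ∀ {L} → IsCycle f L → length L ≡ N
  full-cycle-length (cyc , covers) = trans
    (unique-same-length (cycle-unique cyc) (allFin⁺ N)
      (λ {z} → mk⇔ (λ _ → ∈-allFin z) (λ _ → covers z)))
    (length-tabulate (λ i → i))

  read-from : ∀ r → SingleCycle f → ∃[ rs ] IsCycle f (r ∷ rs) ×
    (∀ k {x} → k < N → iter f k r ≡ x → ∃₂ λ P Q → r ∷ rs ≡ P ++ x ∷ Q × length P ≡ k)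
  read-from r (L , cyc , covers) with restart cyc (covers r)
  ... | rs , rcyc@(_ , ch) , L↭ = rs , full , position
    where
    full : IsCycle f (r ∷ rs)
    full = rcyc , λ h → ∈-resp-↭ L↭ (covers h)
    position : ∀ k {x} → k < N → iter f k r ≡ x → ∃₂ λ P Q → r ∷ rs ≡ P ++ x ∷ Q × length P ≡ k
    position k k<N refl = chain-position r rs ch k
      (s≤s⁻¹ (<-≤-trans k<N (≤-reflexive (sym (full-cycle-length full)))))

  Precedes : Fin N → Fin N → Fin N → Set
  Precedes r a b = ∃₂ λ i j → i < j × j < N × iter f i r ≡ a × iter f j r ≡ b

  ordered-cycle : ∀ {r a b c} → SingleCycle f → Precedes r a b → Precedes r b c →
                  ∃₂ λ B C → ∃[ K ] IsCycle f (a ∷ B ++ b ∷ C ++ c ∷ K)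
  ordered-cycle {r} {a} {b} {c} sc (i , j , i<j , j<N , ra , rb) (i′ , j′ , i′<j′ , j′<N , rb′ , rc)
    with read-from r sc
  ... | rs , rcyc@((u , _) , _) , at
    with at i (<-trans i<j j<N) ra | at j j<N rb | at i′ (<-trans i′<j′ j′<N) rb′ | at j′ j′<N rc
  ... | Pa , _ , La , |Pa| | Pb , _ , Lb , |Pb| | Pb′ , _ , Lb′ , |Pb′| | Pc , Qc , Lc , |Pc|
    with in-order Pa Pb Pb′ Pc u La Lb Lb′ Lc (subst₂ _<_ (sym |Pa|) (sym |Pb|) i<j)
                                              (subst₂ _<_ (sym |Pb′|) (sym |Pc|) i′<j′)
  ... | B , C , split =
    B , C , Qc ++ Pa , subst (IsCycle f) reassoc (rotate-full Pa (subst (IsCycle f) split rcyc))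
    where
    reassoc : a ∷ (B ++ b ∷ C ++ c ∷ Qc) ++ Pa ≡ a ∷ B ++ b ∷ C ++ c ∷ Qc ++ Pa
    reassoc = cong (a ∷_) (trans (++-assoc B _ Pa) (cong (λ w → B ++ b ∷ w) (++-assoc C _ Pa)))

iter-agree-off : ∀ {A : Set} {f g : A → A} {V : List A} →
  (∀ {x} → x ∉ V → f x ∉ V) → (∀ {x} → x ∉ V → g x ≡ f x) →
  ∀ {x} → x ∉ V → ∀ k → iter g k x ≡ iter f k x × iter f k x ∉ V
iter-agree-off f-off g≈f x∉V zero    = refl , x∉V
iter-agree-off {f = f} f-off g≈f x∉V (suc k) =
  let same , out = iter-agree-off f-off g≈f x∉V k in
  trans (g≈f (subst (_∉ _) (sym same) out)) (cong f same) , f-off out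

module _ {N : ℕ} where

  IsOrbitMin : (Fin N → Fin N) → Pred (Fin N) 0ℓ
  IsOrbitMin f h = All (λ k → toℕ h ≤ toℕ (iter f k h)) (upTo N)

  orbitMin? : (f : Fin N → Fin N) → Decidable (IsOrbitMin f)
  orbitMin? f h = all? (λ k → toℕ h ≤? toℕ (iter f k h)) (upTo N)

  cycleMin : Fin N → List (Fin N) → Fin N
  cycleMin = argmin toℕ

  cycleMin∈ : ∀ a hs → cycleMin a hs ∈ a ∷ hs
  cycleMin∈ a hs with argmin-sel toℕ a hs
  ... | inj₁ min≡a  = here min≡a
  ... | inj₂ min∈hs = there min∈hs

  cycleMin≤ : ∀ {a hs c} → c ∈ a ∷ hs → toℕ (cycleMin a hs) ≤ toℕ c
  cycleMin≤ {a} {hs} (here refl) = f[argmin]≤f[⊤] {f = toℕ} a hs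
  cycleMin≤ {a} {hs} (there c∈)  = All.lookup (f[argmin]≤f[xs] {f = toℕ} a hs) c∈

  orbitMin⇔cycleMin : ∀ {f : Fin N → Fin N} {a hs x} → CycleOf f (a ∷ hs) → x ∈ a ∷ hs →
                      IsOrbitMin f x ⇔ x ≡ cycleMin a hs
  orbitMin⇔cycleMin {f} {a} {hs} {x} cyc x∈ = mk⇔ to from
    where
    length≤N : length (a ∷ hs) ≤ N
    length≤N = subst (length (a ∷ hs) ≤_) (length-tabulate {n = N} (λ i → i))
      (unique-length≤ (proj₁ cyc) (λ {z} _ → ∈-allFin z))
    to : IsOrbitMin f x → x ≡ cycleMin a hs
    to min = toℕ-injective (≤-antisym x≤min (cycleMin≤ x∈))
      where
      x≤min : toℕ x ≤ toℕ (cycleMin a hs)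
      x≤min with cycle-reach cyc x∈ (cycleMin∈ a hs)
      ... | k , k< , x↦min = subst (λ w → toℕ x ≤ toℕ w) x↦min
                                   (All.lookup min (∈-upTo⁺ (<-≤-trans k< length≤N)))
    from : x ≡ cycleMin a hs → IsOrbitMin f x
    from refl = All.tabulate (λ {k} _ → cycleMin≤ (cycle-iter cyc x∈ k))

  cycleMin-orbitMin : ∀ {f : Fin N → Fin N} {a hs} → CycleOf f (a ∷ hs) →
                      IsOrbitMin f (cycleMin a hs)
  cycleMin-orbitMin {a = a} {hs} cyc =
    Equivalence.from (orbitMin⇔cycleMin cyc (cycleMin∈ a hs)) refl

  module _ {P : Pred (Fin N) 0ℓ} (P? : Decidable P) (V : List (Fin N)) where

    open import Data.List.Membership.DecPropositional (_≟_ {N}) using (_∈?_)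

    OffV : Pred (Fin N) 0ℓ
    OffV x = P x × x ∉ V

    offV? : Decidable OffV
    offV? x = P? x ×-dec ¬? (x ∈? V)

    count-split : ∀ ms → Unique ms → (∀ {x} → x ∈ ms → x ∈ V) → (∀ {x} → x ∈ V → P x ⇔ x ∈ ms) →
                  length (filter P? (allFin N)) ≡ length (filter offV? (allFin N)) + length ms
    count-split ms ums ms⊆V onV = trans
      (unique-same-length (filter⁺ P? (allFin⁺ N)) (++⁺ (filter⁺ offV? (allFin⁺ N)) ums disjoint)
        (mk⇔ to from))
      (length-++ W)
      where
      W : List (Fin N)
      W = filter offV? (allFin N)
      offV-W : ∀ {x} → x ∈ W → OffV x
      offV-W x∈W = proj₂ (∈-filter⁻ offV? {xs = allFin N} x∈W)
      disjoint : ∀ {x} → ¬ (x ∈ W × x ∈ ms)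
      disjoint (x∈W , x∈ms) = proj₂ (offV-W x∈W) (ms⊆V x∈ms)
      to : ∀ {x} → x ∈ filter P? (allFin N) → x ∈ W ++ ms
      to {x} x∈ with proj₂ (∈-filter⁻ P? {xs = allFin N} x∈) | x ∈? V
      ... | Px | yes x∈V = ∈-++⁺ʳ W (Equivalence.to (onV x∈V) Px)
      ... | Px | no  x∉V = ∈-++⁺ˡ (∈-filter⁺ offV? (∈-allFin x) (Px , x∉V))
      from : ∀ {x} → x ∈ W ++ ms → x ∈ filter P? (allFin N)
      from {x} x∈ with ∈-++⁻ W x∈
      ... | inj₁ x∈W  = ∈-filter⁺ P? (∈-allFin x) (proj₁ (offV-W x∈W))
      ... | inj₂ x∈ms = ∈-filter⁺ P? (∈-allFin x) (Equivalence.from (onV (ms⊆V x∈ms)) x∈ms)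

  count-off-cong : ∀ {P Q : Pred (Fin N) 0ℓ} (P? : Decidable P) (Q? : Decidable Q) V →
    (∀ {x} → x ∉ V → P x ⇔ Q x) →
    length (filter (offV? P? V) (allFin N)) ≡ length (filter (offV? Q? V) (allFin N))
  count-off-cong P? Q? V P⇔Q = unique-same-length
    (filter⁺ (offV? P? V) (allFin⁺ N)) (filter⁺ (offV? Q? V) (allFin⁺ N))
    (mk⇔ (move P? Q? (Equivalence.to ∘ P⇔Q)) (move Q? P? (Equivalence.from ∘ P⇔Q)))
    where
    move : ∀ {R S : Pred (Fin N) 0ℓ} (R? : Decidable R) (S? : Decidable S) →
           (∀ {x} → x ∉ V → R x → S x) →
           ∀ {x} → x ∈ filter (offV? R? V) (allFin N) → x ∈ filter (offV? S? V) (allFin N)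
    move R? S? R⇒S {x} x∈ with proj₂ (∈-filter⁻ (offV? R? V) {xs = allFin N} x∈)
    ... | Rx , x∉V = ∈-filter⁺ (offV? S? V) (∈-allFin x) (R⇒S x∉V Rx , x∉V)

module Merge (n : ℕ) (σ σ̄ : Permutation′ (2 * n)) (a₁ a₂ a₃ : Half n) (hs₁ hs₂ hs₃ : List (Half n))
  (c₁ : CycleOf (σ ⟨$⟩ʳ_) (a₁ ∷ hs₁)) (c₂ : CycleOf (σ ⟨$⟩ʳ_) (a₂ ∷ hs₂))
  (c₃ : CycleOf (σ ⟨$⟩ʳ_) (a₃ ∷ hs₃))
  (σ̄-away : (h : Half n) → h ∉ (a₁ ∷ hs₁) → h ∉ (a₂ ∷ hs₂) → h ∉ (a₃ ∷ hs₃) →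
    σ̄ ⟨$⟩ʳ h ≡ σ ⟨$⟩ʳ h)
  (c̄ : CycleOf (σ̄ ⟨$⟩ʳ_) (a₁ ∷ hs₂ ++ a₂ ∷ hs₃ ++ a₃ ∷ hs₁)) where

  open import Data.List.Membership.DecPropositional (_≟_ {2 * n}) using (_∈?_)

  s s̄ : Half n → Half n
  s  = σ ⟨$⟩ʳ_
  s̄ = σ̄ ⟨$⟩ʳ_

  segment₁ : s̄ a₁ ≡ s a₂ × (∀ {h} → h ∈ hs₂ → s̄ h ≡ s h)
  segment₁ = chain-agree hs₂ (proj₂ c₂) (proj₁ (chain-split (a₁ ∷ hs₂) (proj₂ c̄)))

  segment₂ : s̄ a₂ ≡ s a₃ × (∀ {h} → h ∈ hs₃ → s̄ h ≡ s h)
  segment₂ = chain-agree hs₃ (proj₂ c₃)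
    (proj₁ (chain-split (a₂ ∷ hs₃) (proj₂ (chain-split (a₁ ∷ hs₂) (proj₂ c̄)))))

  segment₃ : s̄ a₃ ≡ s a₁ × (∀ {h} → h ∈ hs₁ → s̄ h ≡ s h)
  segment₃ = chain-agree hs₁ (proj₂ c₁)
    (proj₂ (chain-split (a₂ ∷ hs₃) (proj₂ (chain-split (a₁ ∷ hs₂) (proj₂ c̄)))))

  unmoved : ∀ h → h ≢ a₁ → h ≢ a₂ → h ≢ a₃ → s̄ h ≡ s h
  unmoved h h≢a₁ h≢a₂ h≢a₃ with h ∈? hs₁ | h ∈? hs₂ | h ∈? hs₃
  ... | yes h∈ | _      | _      = proj₂ segment₃ h∈
  ... | no _   | yes h∈ | _      = proj₂ segment₁ h∈
  ... | no _   | no _   | yes h∈ = proj₂ segment₂ h∈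
  ... | no h∉₁ | no h∉₂ | no h∉₃ = σ̄-away h (apart h≢a₁ h∉₁) (apart h≢a₂ h∉₂) (apart h≢a₃ h∉₃)
    where
    apart : ∀ {a hs} → h ≢ a → h ∉ hs → h ∉ a ∷ hs
    apart h≢a h∉hs (here h≡a)  = h≢a h≡a
    apart h≢a h∉hs (there h∈) = h∉hs h∈

  V : List (Half n)
  V = (a₁ ∷ hs₁) ++ (a₂ ∷ hs₂) ++ (a₃ ∷ hs₃)

  C̄ : List (Half n)
  C̄ = a₁ ∷ hs₂ ++ a₂ ∷ hs₃ ++ a₃ ∷ hs₁

  V↭C̄ : V ↭ C̄
  V↭C̄ = ↭-trans (gather a₁ a₂ a₃ hs₁ hs₂ hs₃)
    (↭-trans (↭-prep a₁ (↭-prep a₂ (↭-prep a₃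
               (↭-trans (++-comm hs₁ (hs₂ ++ hs₃)) (↭-reflexive (++-assoc hs₂ hs₃ hs₁))))))
             (↭-sym (gather a₁ a₂ a₃ hs₂ hs₃ hs₁)))

  in-V : ∀ {x} → x ∈ V → x ∈ a₁ ∷ hs₁ ⊎ x ∈ a₂ ∷ hs₂ ⊎ x ∈ a₃ ∷ hs₃
  in-V x∈V with ∈-++⁻ (a₁ ∷ hs₁) x∈V
  ... | inj₁ x∈₁ = inj₁ x∈₁
  ... | inj₂ x∈₂₃ with ∈-++⁻ (a₂ ∷ hs₂) x∈₂₃
  ...   | inj₁ x∈₂ = inj₂ (inj₁ x∈₂)
  ...   | inj₂ x∈₃ = inj₂ (inj₂ x∈₃)

  V₁ : ∀ {x} → x ∈ a₁ ∷ hs₁ → x ∈ V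
  V₁ = ∈-++⁺ˡ
  V₂ : ∀ {x} → x ∈ a₂ ∷ hs₂ → x ∈ V
  V₂ = ∈-++⁺ʳ (a₁ ∷ hs₁) ∘ ∈-++⁺ˡ
  V₃ : ∀ {x} → x ∈ a₃ ∷ hs₃ → x ∈ V
  V₃ = ∈-++⁺ʳ (a₁ ∷ hs₁) ∘ ∈-++⁺ʳ (a₂ ∷ hs₂)

  -- σ maps the complement of V into itself (V is a union of σ-cycles), and
  -- σ̄ agrees with σ there, so off V the orbit minima of σ and σ̄ coincide.
  s-injective : ∀ {x y} → s x ≡ s y → x ≡ y
  s-injective = Injection.injective (↔⇒↣ σ)

  s-off : ∀ {x} → x ∉ V → s x ∉ V
  s-off x∉V sx∈V with in-V sx∈V
  ... | inj₁ sx∈₁        = x∉V (V₁ (cycle-closed⁻ s-injective c₁ sx∈₁))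
  ... | inj₂ (inj₁ sx∈₂) = x∉V (V₂ (cycle-closed⁻ s-injective c₂ sx∈₂))
  ... | inj₂ (inj₂ sx∈₃) = x∉V (V₃ (cycle-closed⁻ s-injective c₃ sx∈₃))

  orbitMin-off : ∀ {x} → x ∉ V → IsOrbitMin s x ⇔ IsOrbitMin s̄ x
  orbitMin-off {x} x∉V = mk⇔ (All.map (λ {k} → subst (λ w → toℕ x ≤ toℕ w) (sym (same k))))
                             (All.map (λ {k} → subst (λ w → toℕ x ≤ toℕ w) (same k)))
    where
    same : ∀ k → iter s̄ k x ≡ iter s k x
    same k = proj₁ (iter-agree-off s-off
      (λ y∉V → σ̄-away _ (y∉V ∘ V₁) (y∉V ∘ V₂) (y∉V ∘ V₃)) x∉V k)

  -- Inside V: σ has the three orbit minima m₁, m₂, m₃, σ̄ only m̄.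
  m₁ m₂ m₃ m̄ : Half n
  m₁ = cycleMin a₁ hs₁
  m₂ = cycleMin a₂ hs₂
  m₃ = cycleMin a₃ hs₃
  m̄ = cycleMin a₁ (hs₂ ++ a₂ ∷ hs₃ ++ a₃ ∷ hs₁)

  orbitMin-in-V : ∀ {x} → x ∈ V → IsOrbitMin s x ⇔ x ∈ m₁ ∷ m₂ ∷ m₃ ∷ []
  orbitMin-in-V {x} x∈V = mk⇔ to from
    where
    to : IsOrbitMin s x → x ∈ m₁ ∷ m₂ ∷ m₃ ∷ []
    to min with in-V x∈V
    ... | inj₁ x∈₁        = here (Equivalence.to (orbitMin⇔cycleMin c₁ x∈₁) min)
    ... | inj₂ (inj₁ x∈₂) = there (here (Equivalence.to (orbitMin⇔cycleMin c₂ x∈₂) min))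
    ... | inj₂ (inj₂ x∈₃) = there (there (here (Equivalence.to (orbitMin⇔cycleMin c₃ x∈₃) min)))
    from : x ∈ m₁ ∷ m₂ ∷ m₃ ∷ [] → IsOrbitMin s x
    from (here refl)                 = cycleMin-orbitMin c₁
    from (there (here refl))         = cycleMin-orbitMin c₂
    from (there (there (here refl))) = cycleMin-orbitMin c₃

  orbitMin̄-in-V : ∀ {x} → x ∈ V → IsOrbitMin s̄ x ⇔ x ∈ m̄ ∷ []
  orbitMin̄-in-V {x} x∈V =
    mk⇔ (here ∘ Equivalence.to min⇔) (λ { (here x≡m̄) → Equivalence.from min⇔ x≡m̄ ; (there ()) })
    where
    min⇔ : IsOrbitMin s̄ x ⇔ x ≡ m̄
    min⇔ = orbitMin⇔cycleMin c̄ (∈-resp-↭ V↭C̄ x∈V)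

  distinct-minima : ¬ SameVertex n σ a₁ a₂ → ¬ SameVertex n σ a₂ a₃ → ¬ SameVertex n σ a₁ a₃ →
                    Unique (m₁ ∷ m₂ ∷ m₃ ∷ [])
  distinct-minima ns₁₂ ns₂₃ ns₁₃ =
    (apart c₁ c₂ ns₁₂ ∷ apart c₁ c₃ ns₁₃ ∷ []) ∷ (apart c₂ c₃ ns₂₃ ∷ []) ∷ [] ∷ []
    where
    apart : ∀ {a b as bs} → CycleOf s (a ∷ as) → CycleOf s (b ∷ bs) → ¬ SameVertex n σ a b →
            cycleMin a as ≢ cycleMin b bs
    apart {a} {b} {as} {bs} ca cb ns m≡m =
      ns (cycles-meet ca cb (cycleMin∈ a as) (subst (_∈ b ∷ bs) (sym m≡m) (cycleMin∈ b bs)))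

  -- Merging three vertices removes exactly two vertices: σ and σ̄ have the
  -- same orbit minima off V, three resp. one on V.
  vertices : ¬ SameVertex n σ a₁ a₂ → ¬ SameVertex n σ a₂ a₃ → ¬ SameVertex n σ a₁ a₃ →
             numCycles n σ̄ + 2 ≡ numCycles n σ
  vertices ns₁₂ ns₂₃ ns₁₃ = begin
    numCycles n σ̄ + 2   ≡⟨ cong (_+ 2) count-σ̄ ⟩
    (|W̄| + 1) + 2       ≡⟨ +-assoc |W̄| 1 2 ⟩
    |W̄| + 3             ≡⟨ cong (_+ 3) (sym same-off-V) ⟩
    |W| + 3              ≡⟨ sym count-σ ⟩
    numCycles n σ        ∎
    where
    open ≡-Reasoning
    |W| |W̄| : ℕ
    |W| = length (filter (offV? (orbitMin? s) V) (allFin (2 * n)))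
    |W̄| = length (filter (offV? (orbitMin? s̄) V) (allFin (2 * n)))
    minima-in-V : ∀ {x} → x ∈ m₁ ∷ m₂ ∷ m₃ ∷ [] → x ∈ V
    minima-in-V (here refl)                 = V₁ (cycleMin∈ a₁ hs₁)
    minima-in-V (there (here refl))         = V₂ (cycleMin∈ a₂ hs₂)
    minima-in-V (there (there (here refl))) = V₃ (cycleMin∈ a₃ hs₃)
    minimum̄-in-V : ∀ {x} → x ∈ m̄ ∷ [] → x ∈ V
    minimum̄-in-V (here refl) = ∈-resp-↭ (↭-sym V↭C̄) (cycleMin∈ a₁ _)
    count-σ : numCycles n σ ≡ |W| + 3
    count-σ = count-split (orbitMin? s) V (m₁ ∷ m₂ ∷ m₃ ∷ [])
      (distinct-minima ns₁₂ ns₂₃ ns₁₃) minima-in-V orbitMin-in-V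
    count-σ̄ : numCycles n σ̄ ≡ |W̄| + 1
    count-σ̄ = count-split (orbitMin? s̄) V (m̄ ∷ []) ([] ∷ []) minimum̄-in-V orbitMin̄-in-V
    same-off-V : |W| ≡ |W̄|
    same-off-V = count-off-cong (orbitMin? s) (orbitMin? s̄) V orbitMin-off

  genus-step : ∀ {g} → ¬ SameVertex n σ a₁ a₂ → ¬ SameVertex n σ a₂ a₃ → ¬ SameVertex n σ a₁ a₃ →
               HasGenus n σ g → HasGenus n σ̄ (suc g)
  genus-step {g} ns₁₂ ns₂₃ ns₁₃ genus = begin
    numCycles n σ̄ + 2 * suc g     ≡⟨ cong (numCycles n σ̄ +_) (*-suc 2 g) ⟩
    numCycles n σ̄ + (2 + 2 * g)   ≡⟨ sym (+-assoc (numCycles n σ̄) 2 (2 * g)) ⟩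
    (numCycles n σ̄ + 2) + 2 * g   ≡⟨ cong (_+ 2 * g) (vertices ns₁₂ ns₂₃ ns₁₃) ⟩
    numCycles n σ + 2 * g          ≡⟨ genus ⟩
    n + 1                          ∎
    where open ≡-Reasoning

lemma1 : (n g : ℕ) (α σ : Permutation′ (2 * n)) (r a₁ a₂ a₃ : Half n) →
    IsUnicellular n α σ → HasGenus n σ g →
    MapLt n α σ r a₁ a₂ → MapLt n α σ r a₂ a₃ →
    ¬ SameVertex n σ a₁ a₂ → ¬ SameVertex n σ a₂ a₃ → ¬ SameVertex n σ a₁ a₃ →
    (hs₁ hs₂ hs₃ : List (Half n)) →
    CycleOf (σ ⟨$⟩ʳ_) (a₁ ∷ hs₁) → CycleOf (σ ⟨$⟩ʳ_) (a₂ ∷ hs₂) →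
    CycleOf (σ ⟨$⟩ʳ_) (a₃ ∷ hs₃) →
    (σ̄ : Permutation′ (2 * n)) →
    ((h : Half n) → h ∉ (a₁ ∷ hs₁) → h ∉ (a₂ ∷ hs₂) → h ∉ (a₃ ∷ hs₃) →
      σ̄ ⟨$⟩ʳ h ≡ σ ⟨$⟩ʳ h) →
    CycleOf (σ̄ ⟨$⟩ʳ_) (a₁ ∷ hs₂ ++ a₂ ∷ hs₃ ++ a₃ ∷ hs₁) →
    (IsUnicellular n α σ̄ × HasGenus n σ̄ (suc g)) ×
    ((ks₁ ks₂ ks₃ : List (Half n)) →
      IsCycle (face n α σ) (a₁ ∷ ks₁ ++ a₂ ∷ ks₂ ++ a₃ ∷ ks₃) →
      IsCycle (face n α σ̄) (a₁ ∷ ks₂ ++ a₃ ∷ ks₁ ++ a₂ ∷ ks₃))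
lemma1 n g α σ r a₁ a₂ a₃ (involution , one-face) genus a₁<a₂ a₂<a₃ ns₁₂ ns₂₃ ns₁₃
       hs₁ hs₂ hs₃ c₁ c₂ c₃ σ̄ σ̄-away c̄ =
  ((involution , new-face-single) , genus-step ns₁₂ ns₂₃ ns₁₃ genus) , new-face
  where
  open Merge n σ σ̄ a₁ a₂ a₃ hs₁ hs₂ hs₃ c₁ c₂ c₃ σ̄-away c̄
  α∘ : ∀ {x y} → x ≡ y → α ⟨$⟩ʳ x ≡ α ⟨$⟩ʳ y
  α∘ = cong (α ⟨$⟩ʳ_)
  -- γ̄ = ασ̄ differs from γ = ασ only by the segment exchange at a₁, a₂, a₃.
  new-face : (ks₁ ks₂ ks₃ : List (Half n)) →
    IsCycle (face n α σ) (a₁ ∷ ks₁ ++ a₂ ∷ ks₂ ++ a₃ ∷ ks₃) →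
    IsCycle (face n α σ̄) (a₁ ∷ ks₂ ++ a₃ ∷ ks₁ ++ a₂ ∷ ks₃)
  new-face ks₁ ks₂ ks₃ = exchange ks₁ ks₂ ks₃
    (α∘ (proj₁ segment₁)) (α∘ (proj₁ segment₂)) (α∘ (proj₁ segment₃))
    (λ h h≢a₁ h≢a₂ h≢a₃ → α∘ (unmoved h h≢a₁ h≢a₂ h≢a₃))
  -- a₁ <_m a₂ <_m a₃ puts the single face of m into the shape new-face needs.
  new-face-single : SingleCycle (face n α σ̄)
  new-face-single with ordered-cycle one-face a₁<a₂ a₂<a₃
  ... | B , C , K , γ-split = _ , new-face B C K γ-split
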